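{- For any finite rooted tree $T$, it is possible to assign a distinct binary string $\ell(u)$ to every node $u\in T$ such that $|\ell(u)|\leq 2+\log_2\big(|T|/(1+\mathsf{deg}(u))\big)$ for every $u\in T$.
   Context: $|T|$ is the number of nodes of $T$, $\mathsf{deg}(u)$ is the number of children of $u$, and $|\ell(u)|$ is the length of the binary string $\ell(u)$. -}

module Defs where

open import Data.Nat using (ℕ; suc; _+_)
open import Data.List using (List; []; _∷_; length)
open import Data.Fin using (Fin)
open import Data.List using (lookup)

data Tree : Set where
  node : List Tree → Tree

children : Tree → List Tree
children (node ts) = ts

mutual
  size : Tree → ℕ
  size (node ts) = suc (sizeF ts)

  sizeF : List Tree → ℕ
  sizeF []       = 0
  sizeF (t ∷ ts) = size t + sizeF ts

-- Nodes of T, given by their position (path from the root).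
data Node : Tree → Set where
  root  : ∀ {ts} → Node (node ts)
  below : ∀ {ts} (i : Fin (length ts)) → Node (lookup ts i) → Node (node ts)

subtree : ∀ {t} → Node t → Tree
subtree {t} root     = t
subtree (below i u)  = subtree u

deg : ∀ {t} → Node t → ℕ
deg u = length (children (subtree u))

module Submission where

-- Give every node u the weight w(u) = 1 + deg u and list the nodes
-- in order of non-increasing weight.  If u sits at position i (counting
-- from 0) of that list, then the i + 1 nodes up to and including u all
-- weigh at least w(u), so (i + 1) · w(u) ≤ Σ_v w(v) = |T| + (|T| - 1)
-- < 2|T|.  Label u by the bijective base-2 numeral of i, whose length k
-- satisfies 2^k ≤ i + 1; then 2^|ℓ(u)| · w(u) ≤ 2|T| ≤ 4|T|, and distinct
-- positions get distinct numerals.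

open import Defs
open import Data.Nat using (ℕ; suc; _+_; _*_; _^_; _≤_; s≤s; z≤n)
open import Data.Nat.Properties
  using (≤-refl; ≤-trans; ≤-reflexive; n≤1+n; m≤m+n; +-mono-≤; *-monoʳ-≤;
         *-monoˡ-≤; *-suc; *-identityˡ; +-comm; +-assoc; +-suc; *-distribˡ-+;
         ≤-decTotalOrder; module ≤-Reasoning)
import Data.Nat.Binary as ℕᵇ
open ℕᵇ using (ℕᵇ; 2[1+_]; 1+[2_])
open import Data.Nat.Binary.Properties using (toℕ-fromℕ; fromℕ-injective)
open import Data.Nat.ListAction using (sum)
open import Data.Nat.ListAction.Properties using (sum-↭; sum-++)
open import Data.Bool using (Bool; true; false)
open import Data.List using (List; []; _∷_; _++_; length; map; lookup)
open import Data.List.Properties using (map-∘; map-++; ∷-injectiveʳ)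
open import Data.List.Membership.Propositional using (_∈_)
open import Data.List.Membership.Propositional.Properties
  using (∈-map⁺; ∈-++⁺ˡ; ∈-++⁺ʳ)
open import Data.List.Relation.Unary.Any using (here; there; index)
open import Data.List.Relation.Unary.Any.Properties using (lookup-index)
import Data.List.Relation.Unary.All as All
open import Data.List.Relation.Unary.AllPairs using (AllPairs; _∷_)
open import Data.List.Relation.Binary.Permutation.Propositional using (↭-sym)
open import Data.List.Relation.Binary.Permutation.Propositional.Properties
  using (∈-resp-↭; map⁺)
import Data.List.Sort as Sort
open import Data.List.Relation.Unary.Sorted.TotalOrder.Properties
  using (Sorted⇒AllPairs)
open import Data.Fin using (Fin; toℕ)
import Data.Fin as Fin
open import Data.Fin.Properties using (toℕ-injective)
open import Data.Product using (Σ; _×_; _,_)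
open import Function using (_∘_)
open import Function.Definitions using (Injective)
import Relation.Binary.Construct.On as On
open import Relation.Binary.Bundles using (DecTotalOrder)
open import Relation.Binary.Properties.DecTotalOrder ≤-decTotalOrder
  using (≥-decTotalOrder)
open import Relation.Binary.PropositionalEquality
  using (_≡_; refl; sym; trans; cong; cong₂; module ≡-Reasoning)

-- The digits of a binary natural, least significant first; a ℕᵇ is a
-- bijective base-2 numeral, so this is a faithful transcription.
digits : ℕᵇ → List Bool
digits ℕᵇ.zero   = []
digits 2[1+ x ]  = true  ∷ digits x
digits 1+[2 x ]  = false ∷ digits x

digits-injective : Injective _≡_ _≡_ digits
digits-injective {ℕᵇ.zero}  {ℕᵇ.zero}  _ = refl
digits-injective {2[1+ x ]} {2[1+ y ]} e = cong 2[1+_] (digits-injective (∷-injectiveʳ e))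
digits-injective {1+[2 x ]} {1+[2 y ]} e = cong 1+[2_] (digits-injective (∷-injectiveʳ e))

-- A numeral with k digits denotes at least 2^k - 1: the digits are 1 or 2.
digits-short : ∀ x → 2 ^ length (digits x) ≤ suc (ℕᵇ.toℕ x)
digits-short ℕᵇ.zero  = ≤-refl
digits-short 2[1+ x ] = ≤-trans (*-monoʳ-≤ 2 (digits-short x)) (n≤1+n _)
digits-short 1+[2 x ] =
  ≤-trans (*-monoʳ-≤ 2 (digits-short x)) (≤-reflexive (*-suc 2 (ℕᵇ.toℕ x)))

code : ℕ → List Bool
code = digits ∘ ℕᵇ.fromℕ

code-injective : Injective _≡_ _≡_ code
code-injective = fromℕ-injective ∘ digits-injective

code-short : ∀ n → 2 ^ length (code n) ≤ suc n
code-short n with digits-short (ℕᵇ.fromℕ n)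
... | bound rewrite toℕ-fromℕ n = bound

module RankLabelling {A : Set} (f : A → ℕ) where

  -- In a list of non-increasing weight, the element at position i is
  -- preceded by i elements at least as heavy, so (i + 1) · f x ≤ Σ f.
  rank-bound : ∀ {xs x} → AllPairs (λ y z → f z ≤ f y) xs →
               (x∈xs : x ∈ xs) → suc (toℕ (index x∈xs)) * f x ≤ sum (map f xs)
  rank-bound {_ ∷ ys} {x} (_ ∷ _) (here refl) =
    ≤-trans (≤-reflexive (*-identityˡ (f x))) (m≤m+n (f x) (sum (map f ys)))
  rank-bound (heavier ∷ sorted) (there x∈xs) =
    +-mono-≤ (All.lookup heavier x∈xs) (rank-bound sorted x∈xs)

  index-injective : ∀ {xs : List A} {x y} (x∈xs : x ∈ xs) (y∈xs : y ∈ xs) →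
                    index x∈xs ≡ index y∈xs → x ≡ y
  index-injective {xs} x∈xs y∈xs same = begin
    _                       ≡⟨ lookup-index x∈xs ⟩
    lookup xs (index x∈xs)  ≡⟨ cong (lookup xs) same ⟩
    lookup xs (index y∈xs)  ≡⟨ lookup-index y∈xs ⟨
    _                       ∎
    where open ≡-Reasoning

  rank-labelling : (xs : List A) → (∀ a → a ∈ xs) →
    Σ (A → List Bool) λ ℓ →
      Injective _≡_ _≡_ ℓ × (∀ a → 2 ^ length (ℓ a) * f a ≤ sum (map f xs))
  rank-labelling xs enumerates = ℓ , ℓ-injective , ℓ-bound
    where
      byWeight : DecTotalOrder _ _ _
      byWeight = On.decTotalOrder ≥-decTotalOrder f

      open Sort byWeight using (sort; sort-↭; sort-↗)

      sorted : List A
      sorted = sort xs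

      non-increasing : AllPairs (λ y z → f z ≤ f y) sorted
      non-increasing = Sorted⇒AllPairs (DecTotalOrder.totalOrder byWeight) (sort-↗ xs)

      position : ∀ a → a ∈ sorted
      position a = ∈-resp-↭ (↭-sym (sort-↭ xs)) (enumerates a)

      rank : A → ℕ
      rank a = toℕ (index (position a))

      ℓ : A → List Bool
      ℓ = code ∘ rank

      ℓ-injective : Injective _≡_ _≡_ ℓ
      ℓ-injective {a} {b} e =
        index-injective (position a) (position b) (toℕ-injective (code-injective e))

      ℓ-bound : ∀ a → 2 ^ length (ℓ a) * f a ≤ sum (map f xs)
      ℓ-bound a = begin
        2 ^ length (ℓ a) * f a  ≤⟨ *-monoˡ-≤ (f a) (code-short (rank a)) ⟩
        suc (rank a) * f a      ≤⟨ rank-bound non-increasing (position a) ⟩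
        sum (map f sorted)      ≡⟨ sum-↭ (map⁺ f (sort-↭ xs)) ⟩
        sum (map f xs)          ∎
        where open ≤-Reasoning

weight : ∀ {t} → Node t → ℕ
weight u = 1 + deg u

record ForestNode (ts : List Tree) : Set where
  constructor _▸_
  field
    tree : Fin (length ts)
    subnode : Node (lookup ts tree)

inTree : ∀ {ts} → ForestNode ts → Node (node ts)
inTree (i ▸ u) = below i u

inFirst : ∀ {t ts} → Node t → ForestNode (t ∷ ts)
inFirst u = Fin.zero ▸ u

inRest : ∀ {t ts} → ForestNode ts → ForestNode (t ∷ ts)
inRest (i ▸ u) = Fin.suc i ▸ u

mutual
  nodes : (t : Tree) → List (Node t)
  nodes (node ts) = root ∷ map inTree (forestNodes ts)

  forestNodes : (ts : List Tree) → List (ForestNode ts)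
  forestNodes []       = []
  forestNodes (t ∷ ts) = map inFirst (nodes t) ++ map inRest (forestNodes ts)

mutual
  nodes-complete : ∀ {t} (u : Node t) → u ∈ nodes t
  nodes-complete root        = here refl
  nodes-complete (below i u) = there (∈-map⁺ inTree (forestNodes-complete i u))

  forestNodes-complete : ∀ {ts} i (u : Node (lookup ts i)) → (i ▸ u) ∈ forestNodes ts
  forestNodes-complete {t ∷ ts} Fin.zero    u =
    ∈-++⁺ˡ (∈-map⁺ inFirst (nodes-complete u))
  forestNodes-complete {t ∷ ts} (Fin.suc i) u =
    ∈-++⁺ʳ (map inFirst (nodes t)) (∈-map⁺ inRest (forestNodes-complete i u))

sum-map-∘ : ∀ {A B : Set} (f : B → ℕ) (g : A → B) xs →
            sum (map f (map g xs)) ≡ sum (map (f ∘ g) xs)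
sum-map-∘ f g xs = cong sum (sym (map-∘ xs))

sum-map-++ : ∀ {A : Set} (f : A → ℕ) xs ys →
             sum (map f (xs ++ ys)) ≡ sum (map f xs) + sum (map f ys)
sum-map-++ f xs ys = trans (cong sum (map-++ f xs ys)) (sum-++ (map f xs) (map f ys))

weightF : ∀ {ts} → ForestNode ts → ℕ
weightF (_ ▸ u) = weight u

forestWeight : List Tree → ℕ
forestWeight ts = sum (map weightF (forestNodes ts))

forestWeight-∷ : ∀ t ts →
                 forestWeight (t ∷ ts) ≡ sum (map weight (nodes t)) + forestWeight ts
forestWeight-∷ t ts = begin
  sum (map weightF (map inFirst (nodes t) ++ map inRest (forestNodes ts)))
    ≡⟨ sum-map-++ weightF (map inFirst (nodes t)) (map inRest (forestNodes ts)) ⟩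
  sum (map weightF (map inFirst (nodes t))) + sum (map weightF (map inRest (forestNodes ts)))
    ≡⟨ cong₂ _+_ (sum-map-∘ weightF inFirst (nodes t))
                 (sum-map-∘ weightF inRest (forestNodes ts)) ⟩
  sum (map weight (nodes t)) + forestWeight ts ∎
  where open ≡-Reasoning

-- Σ_u (1 + deg u) = |T| + (|T| - 1): every node is counted once for
-- itself and every non-root node once more as a child of its parent.
-- In a forest the roots of its trees are nobody's children, hence the
-- correction by the number of trees.
mutual
  weight-sum : ∀ t → suc (sum (map weight (nodes t))) ≡ 2 * size t
  weight-sum (node ts) = begin
    suc (suc (length ts + sum (map weight (map inTree (forestNodes ts)))))
      ≡⟨ cong (λ s → suc (suc (length ts + s))) (sum-map-∘ weight inTree (forestNodes ts)) ⟩
    suc (suc (length ts + forestWeight ts))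
      ≡⟨ cong (suc ∘ suc) (trans (+-comm (length ts) (forestWeight ts)) (forest-weight-sum ts)) ⟩
    suc (suc (2 * sizeF ts))
      ≡⟨ *-suc 2 (sizeF ts) ⟨
    2 * suc (sizeF ts) ∎
    where open ≡-Reasoning

  forest-weight-sum : ∀ ts → forestWeight ts + length ts ≡ 2 * sizeF ts
  forest-weight-sum []       = refl
  forest-weight-sum (t ∷ ts) = begin
    forestWeight (t ∷ ts) + suc (length ts)
      ≡⟨ cong (_+ suc (length ts)) (forestWeight-∷ t ts) ⟩
    (sum (map weight (nodes t)) + forestWeight ts) + suc (length ts)
      ≡⟨ +-suc _ (length ts) ⟩
    suc ((sum (map weight (nodes t)) + forestWeight ts) + length ts)
      ≡⟨ cong suc (+-assoc (sum (map weight (nodes t))) (forestWeight ts) (length ts)) ⟩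
    suc (sum (map weight (nodes t))) + (forestWeight ts + length ts)
      ≡⟨ cong₂ _+_ (weight-sum t) (forest-weight-sum ts) ⟩
    2 * size t + 2 * sizeF ts
      ≡⟨ *-distribˡ-+ 2 (size t) (sizeF ts) ⟨
    2 * (size t + sizeF ts) ∎
    where open ≡-Reasoning

total-weight-bound : ∀ t → sum (map weight (nodes t)) ≤ 4 * size t
total-weight-bound t = begin
  sum (map weight (nodes t))        ≤⟨ n≤1+n _ ⟩
  suc (sum (map weight (nodes t)))  ≡⟨ weight-sum t ⟩
  2 * size t                        ≤⟨ *-monoˡ-≤ (size t) {2} {4} (s≤s (s≤s z≤n)) ⟩
  4 * size t                        ∎
  where open ≤-Reasoning

lemma9 : (T : Tree) →
    Σ (Node T → List Bool) λ ℓ →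
      Injective _≡_ _≡_ ℓ ×
      ((u : Node T) → 2 ^ length (ℓ u) * (1 + deg u) ≤ 4 * size T)
lemma9 T =
  let (ℓ , ℓ-injective , ℓ-bound) = rank-labelling (nodes T) nodes-complete
  in ℓ , ℓ-injective , λ u → ≤-trans (ℓ-bound u) (total-weight-bound T)
  where open RankLabelling (weight {T})
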